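{- Let $k\ge 3$ and $n=3k-2$. Then $W^{(k)}_n$ has exactly two maximal straddling palindromes: the $(k\oplus W^{(k)}_{k-1},\ k\oplus(W^{(k)}_{k-1}(k-1)^{ -1}))$-straddling palindrome and the $(k\oplus(0^{ -1}W^{(k)}_{k-1}),\ k\oplus(W^{(k)}_{k-1}W^{(k)}_{k-1}(0\,(k-1))^{ -1}))$-straddling palindrome.
   Context: The alphabet is $\mathbb{N}=\{0,1,2,\dots\}$. For an integer $k\ge 3$, $\varphi_k$ is the morphism of $\mathbb{N}^*$ defined on letters, for $i\ge 0$ and $0\le j\le k-1$, by $\varphi_k(ki+j)=(ki)(ki+j+1)$ (two letters) if $0\le j\le k-2$, and $\varphi_k(ki+k-1)=(ki+k)$ (one letter). For $n\ge 0$, $W^{(k)}_n=\varphi_k^n(0)$; for $W=w_1\cdots w_r$, $W[s,t]=w_s\cdots w_t$; $c\oplus W$ adds $c$ to every letter of $W$. For a word $W$ ending with the word $U$, $WU^{ -1}$ is $W$ with that suffix deleted, and for $W$ beginning with $U$, $U^{ -1}W$ is $W$ with that prefix deleted; $0\,(k-1)$ is the two-letter word with letters $0,k-1$. For $n\ge k$ let $e=\sum_{i=n-k+1}^{n-1}|W^{(k)}_i|$ (the length of the part $W^{(k)}_{n-1}\cdots W^{(k)}_{n-k+1}$ preceding the final block $k\oplus W^{(k)}_{n-k}$ of $W^{(k)}_n$). A straddling palindrome of $W^{(k)}_n$ is a pair $(s,t)$ with $1\le s\le e<t\le|W^{(k)}_n|$ such that $W^{(k)}_n[s,t]$ is a palindrome;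 it is an $(A,B)$-straddling palindrome if $W^{(k)}_n[s,e]=A$ and $W^{(k)}_n[e+1,t]=B$. It is maximal if there is no straddling palindrome $(s',t')$ with $s'+t'=s+t$ and $t'-s'>t-s$. -}

module Defs where

open import Data.Nat using (ℕ; zero; suc; _+_; _*_; _∸_; _≤_; _<_; _<ᵇ_)
open import Data.Nat.DivMod using (_%_)
open import Data.Bool using (if_then_else_)
open import Data.List using (List; []; _∷_; [_]; _++_; length; take; drop; reverse; concatMap; map; upTo)
open import Data.Nat.ListAction using (sum)
open import Data.Product using (_×_; Σ; ∃)
open import Relation.Binary.PropositionalEquality using (_≡_)

Word : Set
Word = List ℕ

-- φ_k on a letter a = k i + j (0 ≤ j ≤ k-1):
--   j ≤ k-2 : φ_k(a) = (k i) (a+1)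
--   j = k-1 : φ_k(a) = (a+1)            (= k i + k)
-- (k = 0 is a dummy case; the statement only uses k ≥ 3.)
φ-letter : ℕ → ℕ → Word
φ-letter zero    a = [ suc a ]
φ-letter (suc m) a =
  if suc (a % suc m) <ᵇ suc m
  then (a ∸ (a % suc m)) ∷ suc a ∷ []
  else suc a ∷ []

φ : ℕ → Word → Word
φ k w = concatMap (φ-letter k) w

W : ℕ → ℕ → Word
W k zero    = 0 ∷ []
W k (suc n) = φ k (W k n)

_⊕_ : ℕ → Word → Word
c ⊕ U = map (c +_) U

_·_⁻¹ : Word → Word → Word
w · u ⁻¹ = take (length w ∸ length u) w

_⁻¹·_ : Word → Word → Word
u ⁻¹· w = drop (length u) w

-- W[s,t] = w_s ⋯ w_t (1-indexed)
sub : Word → ℕ → ℕ → Word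
sub w s t = take (suc t ∸ s) (drop (s ∸ 1) w)

Palindrome : Word → Set
Palindrome u = reverse u ≡ u

eSplit : ℕ → ℕ → ℕ
eSplit k n = sum (map (λ j → length (W k (n ∸ k + 1 + j))) (upTo (k ∸ 1)))

Straddling : ℕ → ℕ → ℕ → ℕ → Set
Straddling k n s t =
  1 ≤ s × s ≤ eSplit k n × eSplit k n < t × t ≤ length (W k n)
  × Palindrome (sub (W k n) s t)

ABStraddling : ℕ → ℕ → Word → Word → ℕ → ℕ → Set
ABStraddling k n A B s t =
  Straddling k n s t
  × sub (W k n) s (eSplit k n) ≡ A
  × sub (W k n) (suc (eSplit k n)) t ≡ B

MaximalStraddling : ℕ → ℕ → ℕ → ℕ → Set
MaximalStraddling k n s t =
  Straddling k n s t
  × ((s' t' : ℕ) → Straddling k n s' t' → s' + t' ≡ s + t → t' ∸ s' ≤ t ∸ s)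

-- Around the split point, W_{3k-2} reads ⋯ 1 k (k⊕X) t | (k⊕X) t (k⊕Y) (k+1) (2k) ⋯, where X is W_{k-1}
-- without its final letter k - 1, Y is X without its final letters 1 0, and t = 2k - 1 occurs in this
-- stretch only at the two places shown. A straddling palindrome contains the t before the split, so its
-- mirror image is a t as well. The palindrome cannot reach the factor 1 k or (k+1) (2k), because their
-- reversals never occur: in an image under φ_k every 1 is preceded by 0 and every k + 1 by k. Hence it is
-- centred at the first t or midway between the two t's; for each centre the maximal palindrome is the
-- stated one, whose neighbouring letters differ.

module Submission where

open import Defs
open import Data.Nat hiding (_!)
open import Data.Nat.Properties
open import Data.Nat.Tactic.RingSolver using (solve-∀)
open import Data.Nat.DivMod
open import Data.Nat.ListAction using (sum)
open import Data.Bool using (true; false)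
open import Data.List using ([]; _∷_; [_]; _++_; length; take; drop; reverse; applyUpTo)
open import Data.List.Properties
  using (length-++; length-map; ++-assoc; ++-identityʳ; length-take; length-drop; length-reverse; unfold-reverse; reverse-++;
         map-++; map-upTo; concatMap-++; ++-cancelʳ; reverse-map; reverse-involutive)
open import Data.List.Relation.Unary.All using (All; []; _∷_)
import Data.List.Relation.Unary.All as All
open import Data.List.Relation.Unary.All.Properties using (++⁺; ++⁻ˡ; map⁺)
open import Data.Unit using (⊤; tt)
open import Relation.Nullary.Reflects using (ofʸ; ofⁿ)
open import Data.Product using (_×_; Σ; ∃; ∃₂; _,_; proj₁; proj₂)
open import Data.Sum using (_⊎_; inj₁; inj₂)
import Data.Sum as Sum
open import Relation.Nullary using (¬_; yes; no; contradiction)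
open import Relation.Binary.PropositionalEquality hiding ([_])

infixl 9 _!_

-- Positions are 0-indexed, and reading past the end gives the junk letter 0.
_!_ : Word → ℕ → ℕ
[]      ! i     = 0
(x ∷ w) ! zero  = x
(x ∷ w) ! suc i = w ! i

!-++ʳ : ∀ u {v} i → (u ++ v) ! (length u + i) ≡ v ! i
!-++ʳ []      i = refl
!-++ʳ (x ∷ u) i = !-++ʳ u i

!-++-∷ : ∀ u {x v} → (u ++ x ∷ v) ! length u ≡ x
!-++-∷ []      = refl
!-++-∷ (y ∷ u) = !-++-∷ u

!-++-∷-∷ : ∀ u {x y v} → (u ++ x ∷ y ∷ v) ! suc (length u) ≡ y
!-++-∷-∷ []      = refl
!-++-∷-∷ (z ∷ u) = !-++-∷-∷ u

!-++ˡ : ∀ u {v i} → i < length u → (u ++ v) ! i ≡ u ! i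
!-++ˡ (x ∷ u) {i = zero}  _         = refl
!-++ˡ (x ∷ u) {i = suc i} (s≤s i<u) = !-++ˡ u i<u

!-take : ∀ l u {i} → i < l → take l u ! i ≡ u ! i
!-take (suc l) []      _         = refl
!-take (suc l) (x ∷ u) {zero}  _ = refl
!-take (suc l) (x ∷ u) {suc i} (s≤s i<l) = !-take l u i<l

!-drop : ∀ l u i → drop l u ! i ≡ u ! (l + i)
!-drop zero    u       i = refl
!-drop (suc l) []      i = refl
!-drop (suc l) (x ∷ u) i = !-drop l u i

!-reverse : ∀ u a c → suc (a + c) ≡ length u → reverse u ! a ≡ u ! c
!-reverse (x ∷ u) a zero eq = begin
  reverse (x ∷ u) ! a                        ≡⟨ cong (_! a) (unfold-reverse x u) ⟩
  (reverse u ++ [ x ]) ! a                   ≡⟨ cong ((reverse u ++ [ x ]) !_) a≡ ⟩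
  (reverse u ++ [ x ]) ! length (reverse u)  ≡⟨ !-++-∷ (reverse u) ⟩
  x                                          ∎
  where
  open ≡-Reasoning
  a≡ : a ≡ length (reverse u)
  a≡ = trans (sym (+-identityʳ a)) (trans (suc-injective eq) (sym (length-reverse u)))
!-reverse (x ∷ u) a (suc c) eq = begin
  reverse (x ∷ u) ! a       ≡⟨ cong (_! a) (unfold-reverse x u) ⟩
  (reverse u ++ [ x ]) ! a  ≡⟨ !-++ˡ (reverse u) (subst (a <_) (sym (length-reverse u)) a<u) ⟩
  reverse u ! a             ≡⟨ !-reverse u a c eq′ ⟩
  u ! c                     ∎
  where
  open ≡-Reasoning
  eq′ : suc (a + c) ≡ length u
  eq′ = suc-injective (trans (cong suc (sym (+-suc a c))) eq)
  a<u : a < length u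
  a<u = subst (a <_) eq′ (s≤s (m≤m+n a c))

!-All : ∀ {P : ℕ → Set} u {i} → All P u → i < length u → P (u ! i)
!-All (x ∷ u) {zero}  (px ∷ _)  _         = px
!-All (x ∷ u) {suc i} (_  ∷ pu) (s≤s i<u) = !-All u pu i<u

occurrence-split : ∀ {c} u {v p} → All (_≢ c) u → p < length (u ++ c ∷ v) → (u ++ c ∷ v) ! p ≡ c →
                   p ≡ length u ⊎ ∃ λ j → p ≡ suc (length u + j) × j < length v × v ! j ≡ c
occurrence-split []      {p = zero}  _          _         _  = inj₁ refl
occurrence-split []      {p = suc j} _          (s≤s j<v) eq = inj₂ (j , refl , j<v , eq)
occurrence-split (x ∷ u) {p = zero}  (x≢c ∷ _)  _         eq = contradiction eq x≢c
occurrence-split (x ∷ u) {p = suc p} (_ ∷ u≢c)  (s≤s p<)  eq with occurrence-split u u≢c p< eq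
... | inj₁ p≡u               = inj₁ (cong suc p≡u)
... | inj₂ (j , p≡ , j<v , vj) = inj₂ (j , cong suc p≡ , j<v , vj)

⊕-avoids : ∀ c {j} u → All (_< j) u → All (_≢ c + j) (c ⊕ u)
⊕-avoids c u u<j = map⁺ (All.map (λ a<j eq → <-irrefl (+-cancelˡ-≡ c _ _ eq) a<j) u<j)

take-length-++ : ∀ (u : Word) {v} → take (length u) (u ++ v) ≡ u
take-length-++ []      = refl
take-length-++ (x ∷ u) = cong (x ∷_) (take-length-++ u)

drop-length-++ : ∀ (u : Word) {v} → drop (length u) (u ++ v) ≡ v
drop-length-++ []      = refl
drop-length-++ (x ∷ u) = drop-length-++ u

++-·⁻¹ : ∀ u v → (u ++ v) · v ⁻¹ ≡ u
++-·⁻¹ u v = begin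
  take (length (u ++ v) ∸ length v) (u ++ v)  ≡⟨ cong (λ l → take (l ∸ length v) (u ++ v)) (length-++ u) ⟩
  take (length u + length v ∸ length v) (u ++ v) ≡⟨ cong (λ l → take l (u ++ v)) (m+n∸n≡m (length u) (length v)) ⟩
  take (length u) (u ++ v)                    ≡⟨ take-length-++ u ⟩
  u                                           ∎
  where open ≡-Reasoning

sub-++ : ∀ {w} a b c {s t} → w ≡ a ++ b ++ c → s ≡ suc (length a) → t ≡ length a + length b → sub w s t ≡ b
sub-++ a b c refl refl refl = begin
  take (suc (length a + length b) ∸ suc (length a)) (drop (length a) (a ++ b ++ c))
    ≡⟨ cong₂ take (m+n∸m≡n (length a) (length b)) (drop-length-++ a) ⟩
  take (length b) (b ++ c)
    ≡⟨ take-length-++ b ⟩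
  b ∎
  where open ≡-Reasoning

-- Palindromic factors

palindrome-mirror : ∀ {u} → Palindrome u → ∀ a c → suc (a + c) ≡ length u → u ! a ≡ u ! c
palindrome-mirror {u} pal a c eq = trans (cong (_! a) (sym pal)) (!-reverse u a c eq)

0<length-++-∷ : ∀ (u : Word) {x v} → 0 < length (u ++ x ∷ v)
0<length-++-∷ []      = s≤s z≤n
0<length-++-∷ (y ∷ u) = s≤s z≤n

⊕-palindrome : ∀ c {u} → Palindrome u → Palindrome (c ⊕ u)
⊕-palindrome c {u} pal = trans (sym (reverse-map (c +_) u)) (cong (c ⊕_) pal)

reverse-++-palindrome : ∀ u {p} → Palindrome p → Palindrome (reverse u ++ p ++ u)
reverse-++-palindrome u {p} pal = begin
  reverse (reverse u ++ p ++ u)               ≡⟨ reverse-++ (reverse u) (p ++ u) ⟩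
  reverse (p ++ u) ++ reverse (reverse u)     ≡⟨ cong₂ _++_ (reverse-++ p u) (reverse-involutive u) ⟩
  (reverse u ++ reverse p) ++ u               ≡⟨ cong (λ z → (reverse u ++ z) ++ u) pal ⟩
  (reverse u ++ p) ++ u                       ≡⟨ ++-assoc (reverse u) p u ⟩
  reverse u ++ p ++ u                         ∎
  where open ≡-Reasoning

record PalindromicAt (w : Word) (i d : ℕ) : Set where
  constructor palindromicAt
  field
    symmetric : ∀ a c → a + c ≡ d → w ! (i + a) ≡ w ! (i + c)

sub-palindromic : ∀ w i d → i + d < length w → Palindrome (sub w (suc i) (suc (i + d))) → PalindromicAt w i d
sub-palindromic w i d i+d<w pal = palindromicAt λ a c a+c≡d → begin
  w ! (i + a)  ≡⟨ sym (!-drop i w a) ⟩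
  drop i w ! a ≡⟨ sym (!-take (suc d) (drop i w) (s≤s (subst (a ≤_) a+c≡d (m≤m+n a c)))) ⟩
  u ! a        ≡⟨ palindrome-mirror (subst Palindrome sub≡u pal) a c (trans (cong suc a+c≡d) (sym length-u)) ⟩
  u ! c        ≡⟨ !-take (suc d) (drop i w) (s≤s (subst (c ≤_) a+c≡d (m≤n+m c a))) ⟩
  drop i w ! c ≡⟨ !-drop i w c ⟩
  w ! (i + c)  ∎
  where
  open ≡-Reasoning
  u : Word
  u = take (suc d) (drop i w)
  sub≡u : sub w (suc i) (suc (i + d)) ≡ u
  sub≡u = cong (λ l → take l (drop i w)) (trans (cong (_∸ i) (sym (+-suc i d))) (m+n∸m≡n i (suc d)))
  length-u : length u ≡ suc d
  length-u = trans (length-take (suc d) (drop i w))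
    (m≤n⇒m⊓n≡m (subst (suc d ≤_) (sym (length-drop i w))
      (m+n≤o⇒m≤o∸n (suc d) (subst (_≤ length w) (cong suc (+-comm i d)) i+d<w))))

palindromic-mirror : ∀ {w i d p r} → PalindromicAt w i d → i ≤ p → i ≤ r → p + r ≡ i + (i + d) → w ! p ≡ w ! r
palindromic-mirror {i = i} {d} pal i≤p i≤r sum with m≤n⇒∃[o]m+o≡n i≤p | m≤n⇒∃[o]m+o≡n i≤r
... | a , refl | c , refl =
  PalindromicAt.symmetric pal a c (+-cancelˡ-≡ (i + i) (a + c) d (trans (shuffle i a c) (trans sum (sym (+-assoc i i d)))))
  where
  shuffle : ∀ i a c → i + i + (a + c) ≡ i + a + (i + c)
  shuffle = solve-∀

mirror-exists : ∀ {i d p} → i ≤ p → p ≤ i + d → ∃ λ r → i ≤ r × r ≤ i + d × p + r ≡ i + (i + d)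
mirror-exists {i} {d} i≤p p≤i+d with m≤n⇒∃[o]m+o≡n i≤p
... | a , refl with m≤n⇒∃[o]m+o≡n (+-cancelˡ-≤ i a d p≤i+d)
...   | c , refl = i + c , m≤m+n i c , +-monoʳ-≤ i (m≤n+m c a) , shuffle i a c
  where
  shuffle : ∀ i a c → i + a + (i + c) ≡ i + (i + (a + c))
  shuffle = solve-∀

palindromic-reverses-factor : ∀ {w i d p} → PalindromicAt w i d → i ≤ p → suc p ≤ i + d →
                              ∃ λ r → w ! suc r ≡ w ! p × w ! r ≡ w ! suc p
palindromic-reverses-factor {i = i} pal i≤p p<i+d with mirror-exists {i = i} (≤-trans i≤p (n≤1+n _)) p<i+d
... | r , i≤r , _ , sum =
  r , sym (palindromic-mirror pal i≤p (≤-trans i≤r (n≤1+n r)) (trans (+-suc _ r) sum))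
    , sym (palindromic-mirror pal (≤-trans i≤p (n≤1+n _)) i≤r sum)

-- The mirror image of e carries the letter of e, and lies strictly between q and b + 1: a
-- palindrome reaching the factor at q or at b would also contain its reversal.
palindromic-centre : ∀ {w i d q e f b} → PalindromicAt w i d →
  (∀ r → w ! suc r ≡ w ! q → w ! r ≢ w ! suc q) →
  (∀ r → w ! suc r ≡ w ! b → w ! r ≢ w ! suc b) →
  (∀ p → q < p → p ≤ b → w ! p ≡ w ! e → p ≡ e ⊎ p ≡ f) →
  q < e → e ≤ b → i ≤ e → e ≤ i + d →
  i + (i + d) ≡ e + e ⊎ i + (i + d) ≡ e + f
palindromic-centre {i = i} {d} {q} {e} {f} {b} pal left right occurrences q<e e≤b i≤e e≤i+d
  with mirror-exists i≤e e≤i+d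
... | r , i≤r , r≤i+d , sum =
  Sum.map (λ r≡e → trans (sym sum) (cong (e +_) r≡e)) (λ r≡f → trans (sym sum) (cong (e +_) r≡f))
    (occurrences r (<-≤-trans q<i i≤r) (≤-trans r≤i+d i+d≤b) (sym (palindromic-mirror pal i≤e i≤r sum)))
  where
  q<i : q < i
  q<i with i ≤? q
  ... | no  i≰q = ≰⇒> i≰q
  ... | yes i≤q with palindromic-reverses-factor pal i≤q (≤-trans q<e e≤i+d)
  ...   | r′ , fst , snd = contradiction snd (left r′ fst)
  i+d≤b : i + d ≤ b
  i+d≤b with i + d ≤? b
  ... | yes i+d≤b = i+d≤b
  ... | no  i+d≰b with palindromic-reverses-factor pal (≤-trans i≤e e≤b) (≰⇒> i+d≰b)
  ...   | r′ , fst , snd = contradiction snd (right r′ fst)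

straddling-shape : ∀ {k n s t} → Straddling k n s t → ∃₂ λ i d → s ≡ suc i × t ≡ suc (i + d)
straddling-shape {s = suc i} (s≤s z≤n , s≤e , e<t , _) with m≤n⇒∃[o]m+o≡n (≤-trans s≤e (<⇒≤ e<t))
... | d , refl = i , d , refl , refl

endpoints-sum : ∀ i d → suc i + suc (i + d) ≡ suc (suc (i + (i + d)))
endpoints-sum i d = cong suc (+-suc i (i + d))

straddling-palindromic : ∀ {k n i d} → Straddling k n (suc i) (suc (i + d)) → PalindromicAt (W k n) i d
straddling-palindromic {k} {n} {i} {d} (_ , _ , _ , t≤w , pal) = sub-palindromic (W k n) i d t≤w pal

-- Positions σ and suc τ (0-indexed) are the letters just outside the 1-indexed interval [σ + 2, τ + 1].
maximal-if-unextendable : ∀ {k n σ τ} → Straddling k n (suc (suc σ)) (suc τ) → W k n ! σ ≢ W k n ! suc τ →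
                          MaximalStraddling k n (suc (suc σ)) (suc τ)
maximal-if-unextendable {k} {n} {σ} st σ≢τ with straddling-shape {k} {n} st
... | _ , D , refl , refl = st , longest
  where
  longest : (s t : ℕ) → Straddling k n s t → s + t ≡ suc (suc σ) + suc (suc σ + D) →
            t ∸ s ≤ suc (suc σ + D) ∸ suc (suc σ)
  longest s t st′ sum with straddling-shape {k} {n} st′
  ... | i , d , refl , refl with d ≤? D
  ...   | yes d≤D = subst₂ _≤_ (sym (m+n∸m≡n i d)) (sym (m+n∸m≡n (suc σ) D)) d≤D
  ...   | no  d≰D = contradiction (palindromic-mirror (straddling-palindromic {k} {n} st′) i≤σ i≤τ centre) σ≢τ
    where
    centre : σ + suc (suc σ + D) ≡ i + (i + d)
    centre = sym (suc-injective (suc-injective (trans (sym (endpoints-sum i d)) sum)))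
    i≤σ : i ≤ σ
    i≤σ with i ≤? σ
    ... | yes i≤σ = i≤σ
    ... | no  i≰σ = contradiction (subst₂ _≤_ (extend σ D) (sym centre) (+-mono-≤ σ<i (+-mono-≤ σ<i (≰⇒> d≰D)))) (n≮n _)
      where
      σ<i : suc σ ≤ i
      σ<i = ≰⇒> i≰σ
      extend : ∀ σ D → suc σ + (suc σ + suc D) ≡ suc (σ + suc (suc σ + D))
      extend = solve-∀
    i≤τ : i ≤ suc (suc σ + D)
    i≤τ = ≤-trans i≤σ (m≤n⇒m≤1+n (m≤n⇒m≤1+n (m≤m+n σ D)))

m+m≡n+n⇒m≡n : ∀ {m n} → m + m ≡ n + n → m ≡ n
m+m≡n+n⇒m≡n {m} {n} eq = *-cancelˡ-≡ m n 2 (trans (cong (m +_) (+-identityʳ m)) (trans eq (cong (n +_) (sym (+-identityʳ n)))))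

maximal-unique : ∀ {k n s t s′ t′} → MaximalStraddling k n s t → MaximalStraddling k n s′ t′ →
                 s + t ≡ s′ + t′ → s ≡ s′ × t ≡ t′
maximal-unique {k} {n} (st , longest) (st′ , longest′) sum with straddling-shape {k} {n} st | straddling-shape {k} {n} st′
... | i , d , refl , refl | i′ , d′ , refl , refl = cong suc i≡i′ , cong suc (cong₂ _+_ i≡i′ d≡d′)
  where
  d≡d′ : d ≡ d′
  d≡d′ = ≤-antisym (subst₂ _≤_ (m+n∸m≡n i d) (m+n∸m≡n i′ d′) (longest′ _ _ st sum))
                   (subst₂ _≤_ (m+n∸m≡n i′ d′) (m+n∸m≡n i d) (longest _ _ st′ (sym sum)))
  centre : i + (i + d) ≡ i′ + (i′ + d′)
  centre = suc-injective (suc-injective (trans (sym (endpoints-sum i d)) (trans sum (endpoints-sum i′ d′))))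
  i≡i′ : i ≡ i′
  i≡i′ = m+m≡n+n⇒m≡n (+-cancelʳ-≡ d (i + i) (i′ + i′) (begin
    i + i + d       ≡⟨ +-assoc i i d ⟩
    i + (i + d)     ≡⟨ centre ⟩
    i′ + (i′ + d′)  ≡⟨ cong (λ x → i′ + (i′ + x)) (sym d≡d′) ⟩
    i′ + (i′ + d)   ≡⟨ sym (+-assoc i′ i′ d) ⟩
    i′ + i′ + d     ∎))
    where open ≡-Reasoning

maximal-agrees : ∀ {k n A B s t s′ t′} → MaximalStraddling k n s t →
                 MaximalStraddling k n s′ t′ × ABStraddling k n A B s′ t′ → s + t ≡ s′ + t′ → ABStraddling k n A B s t
maximal-agrees {k} {n} mx (mx′ , ab′) sum with maximal-unique {k} {n} mx mx′ sum
... | refl , refl = ab′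

ABStraddling-intro : ∀ {k n} a A B c {s t} → W k n ≡ a ++ A ++ B ++ c → eSplit k n ≡ length a + length A →
  0 < length A → 0 < length B → Palindrome (A ++ B) →
  s ≡ suc (length a) → t ≡ length a + length A + length B → ABStraddling k n A B s t
ABStraddling-intro {k} {n} a A B c w≡ e≡ 0<A 0<B pal refl refl =
  (s≤s z≤n , subst (suc (length a) ≤_) (sym e≡) (m<m+n (length a) 0<A)
    , subst (_< length a + length A + length B) (sym e≡) (m<m+n (length a + length A) 0<B)
    , subst (length a + length A + length B ≤_) (sym length-w) (m≤m+n _ (length c))
    , subst Palindrome (sym (sub-++ a (A ++ B) c (trans w≡ (cong (a ++_) (sym (++-assoc A B c)))) refl
                                  (trans (+-assoc (length a) _ _) (cong (length a +_) (sym (length-++ A))))))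
                       pal)
  , sub-++ a A (B ++ c) w≡ refl e≡
  , sub-++ (a ++ A) B c (trans w≡ (sym (++-assoc a A (B ++ c)))) (cong suc (trans e≡ (sym (length-++ a))))
                        (cong (_+ length B) (sym (length-++ a)))
  where
  length-w : length (W k n) ≡ length a + length A + length B + length c
  length-w = begin
    length (W k n)                                           ≡⟨ cong length w≡ ⟩
    length (a ++ A ++ B ++ c)                                ≡⟨ length-++ a ⟩
    length a + length (A ++ B ++ c)                          ≡⟨ cong (length a +_) (length-++ A) ⟩
    length a + (length A + length (B ++ c))                  ≡⟨ cong (λ l → length a + (length A + l)) (length-++ B) ⟩
    length a + (length A + (length B + length c))            ≡⟨ reassoc (length a) (length A) (length B) (length c) ⟩
    length a + length A + length B + length c               ∎
    where
    open ≡-Reasoning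
    reassoc : ∀ a b c d → a + (b + (c + d)) ≡ a + b + c + d
    reassoc = solve-∀

maximal-witness : ∀ {k n} a x A B y c → W k n ≡ a ++ x ∷ A ++ B ++ y ∷ c → x ≢ y →
  eSplit k n ≡ suc (length a + length A) → 0 < length A → 0 < length B → Palindrome (A ++ B) →
  let s = suc (suc (length a)); t = suc (length a + length A + length B) in
  MaximalStraddling k n s t × ABStraddling k n A B s t
maximal-witness {k} {n} a x A B y c w≡ x≢y e≡ 0<A 0<B pal =
  maximal-if-unextendable {k} {n} (proj₁ ab) (λ eq → x≢y (trans (sym at-a) (trans eq at-t))) , ab
  where
  ax≡ : length (a ++ [ x ]) ≡ suc (length a)
  ax≡ = trans (length-++ a) (+-comm (length a) 1)
  ab : ABStraddling k n A B (suc (suc (length a))) (suc (length a + length A + length B))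
  ab = ABStraddling-intro {k} {n} (a ++ [ x ]) A B (y ∷ c) (trans w≡ (sym (++-assoc a [ x ] _)))
         (trans e≡ (cong (_+ length A) (sym ax≡))) 0<A 0<B pal (cong suc (sym ax≡))
         (cong (λ l → l + length A + length B) (sym ax≡))
  at-a : W k n ! length a ≡ x
  at-a = trans (cong (_! length a) w≡) (!-++-∷ a)
  at-t : W k n ! suc (length a + length A + length B) ≡ y
  at-t = begin
    W k n ! suc (length a + length A + length B)     ≡⟨ cong₂ _!_ w≡ (trans (cong suc (+-assoc (length a) _ _)) (sym (+-suc (length a) _))) ⟩
    (a ++ x ∷ A ++ B ++ y ∷ c) ! (length a + suc (length A + length B)) ≡⟨ !-++ʳ a _ ⟩
    (A ++ B ++ y ∷ c) ! (length A + length B)        ≡⟨ !-++ʳ A _ ⟩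
    (B ++ y ∷ c) ! length B                          ≡⟨ !-++-∷ B ⟩
    y                                                ∎
    where open ≡-Reasoning

-- The words W_n

[m∸m%n]%n≡0 : ∀ m n .{{_ : NonZero n}} → (m ∸ m % n) % n ≡ 0
[m∸m%n]%n≡0 m n = trans (cong (λ x → (x ∸ m % n) % n) (m≡m%n+[m/n]*n m n))
                        (trans (cong (_% n) (m+n∸m≡n (m % n) (m / n * n))) (m*n%n≡0 (m / n) n))

-- Every letter suc d of p ∷ w other than p is immediately preceded by d.
Preceded : ℕ → ℕ → Word → Set
Preceded d p []      = ⊤
Preceded d p (x ∷ w) = (x ≡ suc d → p ≡ d) × Preceded d x w

Preceded-! : ∀ {d} p w → Preceded d p w → ∀ i → w ! suc i ≡ suc d → w ! i ≡ d
Preceded-! p (x ∷ [])    _           i       ()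
Preceded-! p (x ∷ y ∷ w) (_ , y≡ , _) zero    eq = y≡ eq
Preceded-! p (x ∷ y ∷ w) (_ , rest)   (suc i) eq = Preceded-! x (y ∷ w) rest i eq

zimin : ℕ → Word
zimin zero    = []
zimin (suc j) = zimin j ++ j ∷ zimin j

zimin-palindrome : ∀ j → Palindrome (zimin j)
zimin-palindrome zero    = refl
zimin-palindrome (suc j) = begin
  reverse (zimin j ++ j ∷ zimin j)                  ≡⟨ reverse-++ (zimin j) (j ∷ zimin j) ⟩
  reverse (j ∷ zimin j) ++ reverse (zimin j)        ≡⟨ cong (_++ reverse (zimin j)) (unfold-reverse j (zimin j)) ⟩
  (reverse (zimin j) ++ [ j ]) ++ reverse (zimin j) ≡⟨ ++-assoc (reverse (zimin j)) [ j ] (reverse (zimin j)) ⟩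
  reverse (zimin j) ++ j ∷ reverse (zimin j)        ≡⟨ cong (λ z → z ++ j ∷ z) (zimin-palindrome j) ⟩
  zimin j ++ j ∷ zimin j                            ∎
  where open ≡-Reasoning

zimin-< : ∀ j → All (_< j) (zimin j)
zimin-< zero    = []
zimin-< (suc j) = ++⁺ smaller (n<1+n j ∷ smaller)
  where
  smaller : All (_< suc j) (zimin j)
  smaller = All.map m<n⇒m<1+n (zimin-< j)

zimin-ends-with-0 : ∀ j → ∃ λ V → zimin (suc j) ≡ V ++ [ 0 ]
zimin-ends-with-0 zero    = [] , refl
zimin-ends-with-0 (suc j) with zimin-ends-with-0 j
... | V , eq = zimin (suc j) ++ suc j ∷ V
             , trans (cong (λ z → zimin (suc j) ++ suc j ∷ z) eq) (sym (++-assoc (zimin (suc j)) (suc j ∷ V) [ 0 ]))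

-- blocks k i r = W_{i+r-1} ⋯ W_{i+1} W_i; the paper's W_{n-1} ⋯ W_{n-k+1} is blocks k (n-k+1) (k-1).
blocks : ℕ → ℕ → ℕ → Word
blocks k i zero    = []
blocks k i (suc r) = blocks k (suc i) r ++ W k i

blocks-suc : ∀ k i r → blocks k i (suc r) ≡ W k (i + r) ++ blocks k i r
blocks-suc k i zero    = trans (sym (++-identityʳ (W k i))) (cong (λ j → W k j ++ []) (sym (+-identityʳ i)))
blocks-suc k i (suc r) = begin
  blocks k (suc i) (suc r) ++ W k i                ≡⟨ cong (_++ W k i) (blocks-suc k (suc i) r) ⟩
  (W k (suc i + r) ++ blocks k (suc i) r) ++ W k i ≡⟨ ++-assoc (W k (suc i + r)) (blocks k (suc i) r) (W k i) ⟩
  W k (suc i + r) ++ blocks k i (suc r)            ≡⟨ cong (λ j → W k j ++ blocks k i (suc r)) (sym (+-suc i r)) ⟩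
  W k (i + suc r) ++ blocks k i (suc r)            ∎
  where open ≡-Reasoning

length-blocks : ∀ k i r (f : ℕ → ℕ) → (∀ j → f j ≡ length (W k (i + j))) → length (blocks k i r) ≡ sum (applyUpTo f r)
length-blocks k i zero    f f≡ = refl
length-blocks k i (suc r) f f≡ = begin
  length (blocks k (suc i) r ++ W k i)      ≡⟨ length-++ (blocks k (suc i) r) ⟩
  length (blocks k (suc i) r) + length (W k i) ≡⟨ +-comm (length (blocks k (suc i) r)) _ ⟩
  length (W k i) + length (blocks k (suc i) r)
    ≡⟨ cong₂ _+_ (sym (trans (f≡ 0) (cong (λ j → length (W k j)) (+-identityʳ i))))
                 (length-blocks k (suc i) r (λ j → f (suc j)) (λ j → trans (f≡ (suc j)) (cong (λ l → length (W k l)) (+-suc i j)))) ⟩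
  f 0 + sum (applyUpTo (λ j → f (suc j)) r) ∎
  where open ≡-Reasoning

eSplit-blocks : ∀ k n → eSplit k n ≡ length (blocks k (n ∸ k + 1) (k ∸ 1))
eSplit-blocks k n = trans (cong sum (map-upTo _ (k ∸ 1))) (sym (length-blocks k (n ∸ k + 1) (k ∸ 1) _ (λ j → refl)))

module Morphism (m : ℕ) where

  k : ℕ
  k = 2 + m

  φ-++ : ∀ u v → φ k (u ++ v) ≡ φ k u ++ φ k v
  φ-++ = concatMap-++ (φ-letter k)

  φ-letter-inner : ∀ a → suc (a % k) < k → φ-letter k a ≡ (a ∸ a % k) ∷ suc a ∷ []
  φ-letter-inner a a%k<k-1 with suc (a % k) <ᵇ k | <ᵇ-reflects-< (suc (a % k)) k
  ... | true  | _      = refl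
  ... | false | ofⁿ ¬p = contradiction a%k<k-1 ¬p

  φ-letter-final : ∀ a → ¬ suc (a % k) < k → φ-letter k a ≡ suc a ∷ []
  φ-letter-final a a%k≡k-1 with suc (a % k) <ᵇ k | <ᵇ-reflects-< (suc (a % k)) k
  ... | true  | ofʸ p = contradiction p a%k≡k-1
  ... | false | _     = refl

  φ-letter-small : ∀ j → suc j < k → φ-letter k j ≡ 0 ∷ suc j ∷ []
  φ-letter-small j j<k-1 = begin
    φ-letter k j                 ≡⟨ φ-letter-inner j (subst (λ r → suc r < k) (sym j%k≡j) j<k-1) ⟩
    (j ∸ j % k) ∷ suc j ∷ []     ≡⟨ cong (λ r → (j ∸ r) ∷ suc j ∷ []) j%k≡j ⟩
    (j ∸ j) ∷ suc j ∷ []         ≡⟨ cong (_∷ suc j ∷ []) (n∸n≡0 j) ⟩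
    0 ∷ suc j ∷ []               ∎
    where
    open ≡-Reasoning
    j%k≡j : j % k ≡ j
    j%k≡j = m<n⇒m%n≡m (<-trans (n<1+n j) j<k-1)

  φ-letter-last : φ-letter k (suc m) ≡ [ k ]
  φ-letter-last = φ-letter-final (suc m) (subst (λ r → ¬ suc r < k) (sym (m<n⇒m%n≡m (n<1+n (suc m)))) (n≮n k))

  %-k+ : ∀ a → (k + a) % k ≡ a % k
  %-k+ a = trans (cong (_% k) (+-comm k a)) ([m+n]%n≡m%n a k)

  φ-letter-shift : ∀ a → φ-letter k (k + a) ≡ k ⊕ φ-letter k a
  φ-letter-shift a with suc (a % k) <? k
  ... | yes inner = begin
    φ-letter k (k + a)                           ≡⟨ φ-letter-inner (k + a) (subst (λ r → suc r < k) (sym (%-k+ a)) inner) ⟩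
    (k + a ∸ (k + a) % k) ∷ suc (k + a) ∷ []     ≡⟨ cong₂ (λ x y → x ∷ y ∷ []) (trans (cong (k + a ∸_) (%-k+ a)) (+-∸-assoc k (m%n≤m a k))) (sym (+-suc k a)) ⟩
    (k + (a ∸ a % k)) ∷ (k + suc a) ∷ []         ≡⟨ cong (k ⊕_) (sym (φ-letter-inner a inner)) ⟩
    k ⊕ φ-letter k a                             ∎
    where open ≡-Reasoning
  ... | no final = begin
    φ-letter k (k + a)   ≡⟨ φ-letter-final (k + a) (subst (λ r → ¬ suc r < k) (sym (%-k+ a)) final) ⟩
    suc (k + a) ∷ []     ≡⟨ cong [_] (sym (+-suc k a)) ⟩
    k ⊕ (suc a ∷ [])     ≡⟨ cong (k ⊕_) (sym (φ-letter-final a final)) ⟩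
    k ⊕ φ-letter k a     ∎
    where open ≡-Reasoning

  φ-⊕ : ∀ u → φ k (k ⊕ u) ≡ k ⊕ φ k u
  φ-⊕ []      = refl
  φ-⊕ (a ∷ u) = trans (cong₂ _++_ (φ-letter-shift a) (φ-⊕ u)) (sym (map-++ (k +_) (φ-letter k a) (φ k u)))

  φ-zimin : ∀ j → j < k → φ k (zimin j) ++ [ 0 ] ≡ zimin (suc j)
  φ-zimin zero    _      = refl
  φ-zimin (suc j) j<k = begin
    φ k (zimin j ++ j ∷ zimin j) ++ [ 0 ]
      ≡⟨ cong (_++ [ 0 ]) (φ-++ (zimin j) (j ∷ zimin j)) ⟩
    (φ k (zimin j) ++ φ-letter k j ++ φ k (zimin j)) ++ [ 0 ]
      ≡⟨ cong (λ z → (φ k (zimin j) ++ z ++ φ k (zimin j)) ++ [ 0 ]) (φ-letter-small j j<k) ⟩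
    (φ k (zimin j) ++ 0 ∷ suc j ∷ φ k (zimin j)) ++ [ 0 ]
      ≡⟨ ++-assoc (φ k (zimin j)) (0 ∷ suc j ∷ φ k (zimin j)) [ 0 ] ⟩
    φ k (zimin j) ++ 0 ∷ suc j ∷ (φ k (zimin j) ++ [ 0 ])
      ≡⟨ cong (λ z → φ k (zimin j) ++ 0 ∷ suc j ∷ z) IH ⟩
    φ k (zimin j) ++ 0 ∷ suc j ∷ zimin (suc j)
      ≡⟨ sym (++-assoc (φ k (zimin j)) [ 0 ] (suc j ∷ zimin (suc j))) ⟩
    (φ k (zimin j) ++ [ 0 ]) ++ suc j ∷ zimin (suc j)
      ≡⟨ cong (_++ suc j ∷ zimin (suc j)) IH ⟩
    zimin (suc j) ++ suc j ∷ zimin (suc j) ∎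
    where
    open ≡-Reasoning
    IH : φ k (zimin j) ++ [ 0 ] ≡ zimin (suc j)
    IH = φ-zimin j (<-trans (n<1+n j) j<k)

  W-zimin : ∀ j → j < k → W k j ≡ zimin j ++ [ j ]
  W-zimin zero    _   = refl
  W-zimin (suc j) j<k = begin
    φ k (W k j)                       ≡⟨ cong (φ k) (W-zimin j (<-trans (n<1+n j) j<k)) ⟩
    φ k (zimin j ++ [ j ])            ≡⟨ φ-++ (zimin j) [ j ] ⟩
    φ k (zimin j) ++ φ-letter k j ++ [] ≡⟨ cong (λ z → φ k (zimin j) ++ z ++ []) (φ-letter-small j j<k) ⟩
    φ k (zimin j) ++ 0 ∷ suc j ∷ []   ≡⟨ sym (++-assoc (φ k (zimin j)) [ 0 ] [ suc j ]) ⟩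
    (φ k (zimin j) ++ [ 0 ]) ++ [ suc j ] ≡⟨ cong (_++ [ suc j ]) (φ-zimin j (<-trans (n<1+n j) j<k)) ⟩
    zimin (suc j) ++ [ suc j ]        ∎
    where open ≡-Reasoning

  φ-blocks : ∀ i r → φ k (blocks k i r) ≡ blocks k (suc i) r
  φ-blocks i zero    = refl
  φ-blocks i (suc r) = trans (φ-++ (blocks k (suc i) r) (W k i)) (cong (_++ W k (suc i)) (φ-blocks (suc i) r))

  zimin-blocks : ∀ j → j ≤ k → zimin j ≡ blocks k 0 j
  zimin-blocks zero    _   = refl
  zimin-blocks (suc j) j<k = begin
    zimin j ++ j ∷ zimin j     ≡⟨ sym (++-assoc (zimin j) [ j ] (zimin j)) ⟩
    (zimin j ++ [ j ]) ++ zimin j ≡⟨ cong₂ _++_ (sym (W-zimin j j<k)) (zimin-blocks j (<⇒≤ j<k)) ⟩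
    W k j ++ blocks k 0 j      ≡⟨ sym (blocks-suc k 0 j) ⟩
    blocks k 0 (suc j)         ∎
    where open ≡-Reasoning

  W-recurrence : ∀ i → W k (i + k) ≡ blocks k (suc i) (suc m) ++ k ⊕ W k i
  W-recurrence zero = begin
    φ k (W k (suc m))                      ≡⟨ cong (φ k) (W-zimin (suc m) ≤-refl) ⟩
    φ k (zimin (suc m) ++ [ suc m ])        ≡⟨ φ-++ (zimin (suc m)) [ suc m ] ⟩
    φ k (zimin (suc m)) ++ φ-letter k (suc m) ++ []
      ≡⟨ cong₂ (λ u v → u ++ v ++ []) (trans (cong (φ k) (zimin-blocks (suc m) (n≤1+n _))) (φ-blocks 0 (suc m))) φ-letter-last ⟩
    blocks k 1 (suc m) ++ [ k ]             ≡⟨ cong (λ x → blocks k 1 (suc m) ++ [ x ]) (sym (+-identityʳ k)) ⟩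
    blocks k 1 (suc m) ++ [ k + 0 ]         ∎
    where open ≡-Reasoning
  W-recurrence (suc i) = begin
    φ k (W k (i + k))                              ≡⟨ cong (φ k) (W-recurrence i) ⟩
    φ k (blocks k (suc i) (suc m) ++ k ⊕ W k i)    ≡⟨ φ-++ (blocks k (suc i) (suc m)) (k ⊕ W k i) ⟩
    φ k (blocks k (suc i) (suc m)) ++ φ k (k ⊕ W k i) ≡⟨ cong₂ _++_ (φ-blocks (suc i) (suc m)) (φ-⊕ (W k i)) ⟩
    blocks k (suc (suc i)) (suc m) ++ k ⊕ W k (suc i) ∎
    where open ≡-Reasoning

  W-suc-prefix : ∀ i → ∃ λ v → W k (suc i) ≡ W k i ++ v
  W-suc-prefix zero    = [ 1 ] , cong (_++ []) (φ-letter-small 0 (s≤s (s≤s z≤n)))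
  W-suc-prefix (suc i) with W-suc-prefix i
  ... | v , eq = φ k v , trans (cong (φ k) eq) (φ-++ (W k i) v)

  W-prefix : ∀ i j → ∃ λ v → W k (i + j) ≡ W k i ++ v
  W-prefix i zero    = [] , trans (cong (W k) (+-identityʳ i)) (sym (++-identityʳ (W k i)))
  W-prefix i (suc j) with W-prefix i j | W-suc-prefix (i + j)
  ... | v , eq | v′ , eq′ = v ++ v′ , (begin
    W k (i + suc j)          ≡⟨ cong (W k) (+-suc i j) ⟩
    W k (suc (i + j))        ≡⟨ eq′ ⟩
    W k (i + j) ++ v′        ≡⟨ cong (_++ v′) eq ⟩
    (W k i ++ v) ++ v′       ≡⟨ ++-assoc (W k i) v v′ ⟩
    W k i ++ v ++ v′         ∎)
    where open ≡-Reasoning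

  φ-Preceded : ∀ {d} → d % k ≡ 0 → ∀ u p → Preceded d p (φ k u)
  φ-Preceded d%k≡0 []      p = tt
  φ-Preceded {d} d%k≡0 (a ∷ u) p with suc (a % k) <? k
  ... | yes inner = subst (λ z → Preceded d p (z ++ φ k u)) (sym (φ-letter-inner a inner))
                      (first , second , φ-Preceded d%k≡0 u (suc a))
    where
    first : a ∸ a % k ≡ suc d → p ≡ d
    first eq = contradiction (trans (sym ([m∸m%n]%n≡0 a k)) (trans (cong (_% k) eq) (%-distribˡ-+ 1 d k)))
                 (subst (λ r → 0 ≢ (1 + r) % k) (sym d%k≡0) (λ ()))
    second : suc a ≡ suc d → a ∸ a % k ≡ d
    second refl = cong (d ∸_) d%k≡0
  ... | no final = subst (λ z → Preceded d p (z ++ φ k u)) (sym (φ-letter-final a final))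
                     (first , φ-Preceded d%k≡0 u (suc a))
    where
    first : suc a ≡ suc d → p ≡ d
    first refl = contradiction (subst (λ r → suc r < k) (sym d%k≡0) (s≤s (s≤s z≤n))) final

  -- In an image under φ_k, a letter d + 1 with k ∣ d can only come from φ_k(d) = d (d + 1).
  φ-preceded : ∀ u {d} → d % k ≡ 0 → ∀ i → φ k u ! suc i ≡ suc d → φ k u ! i ≡ d
  φ-preceded u d%k≡0 = Preceded-! 0 (φ k u) (φ-Preceded d%k≡0 u 0)

-- The neighbourhood of the split point of W_{3k-2}

module Window (L U V T S : Word) (x y c x′ y′ : ℕ) where

  word : Word
  word = L ++ x ∷ y ∷ U ++ c ∷ V ++ c ∷ T ++ x′ ∷ y′ ∷ S

  q e f b : ℕ
  q = length L
  e = q + suc (suc (length U))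
  f = q + suc (suc (length U + suc (length V)))
  b = q + suc (suc (length U + suc (length V + suc (length T))))

  at-q : word ! q ≡ x
  at-q = !-++-∷ L

  at-suc-q : word ! suc q ≡ y
  at-suc-q = !-++-∷-∷ L

  at-e : word ! e ≡ c
  at-e = trans (!-++ʳ L _) (!-++-∷ U)

  at-b : word ! b ≡ x′
  at-b = trans (!-++ʳ L _) (trans (!-++ʳ U _) (trans (!-++ʳ V _) (!-++-∷ T)))

  at-suc-b : word ! suc b ≡ y′
  at-suc-b = trans (cong (word !_) (shift q (length U) (length V) (length T)))
               (trans (!-++ʳ L _) (trans (!-++ʳ U _) (trans (!-++ʳ V _) (!-++-∷-∷ T))))
    where
    shift : ∀ q u v t → suc (q + suc (suc (u + suc (v + suc t)))) ≡ q + suc (suc (u + suc (v + suc (suc t))))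
    shift = solve-∀

  window : Word
  window = y ∷ U ++ c ∷ V ++ c ∷ T ++ [ x′ ]

  word≡ : word ≡ L ++ x ∷ window ++ y′ ∷ S
  word≡ = cong (λ z → L ++ x ∷ y ∷ z) (begin
    U ++ c ∷ V ++ c ∷ T ++ x′ ∷ y′ ∷ S           ≡⟨ cong (λ z → U ++ c ∷ V ++ c ∷ z) (sym (++-assoc T [ x′ ] _)) ⟩
    U ++ c ∷ V ++ c ∷ (T ++ [ x′ ]) ++ y′ ∷ S     ≡⟨ cong (λ z → U ++ c ∷ z) (sym (++-assoc V (c ∷ T ++ [ x′ ]) _)) ⟩
    U ++ c ∷ (V ++ c ∷ T ++ [ x′ ]) ++ y′ ∷ S     ≡⟨ sym (++-assoc U (c ∷ V ++ c ∷ T ++ [ x′ ]) _) ⟩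
    (U ++ c ∷ V ++ c ∷ T ++ [ x′ ]) ++ y′ ∷ S     ∎)
    where open ≡-Reasoning

  length-window : length window ≡ suc (suc (length U + suc (length V + suc (length T))))
  length-window = cong suc (begin
    length (U ++ c ∷ V ++ c ∷ T ++ [ x′ ])             ≡⟨ length-++ U ⟩
    length U + suc (length (V ++ c ∷ T ++ [ x′ ]))     ≡⟨ cong (λ l → length U + suc l) (length-++ V) ⟩
    length U + suc (length V + suc (length (T ++ [ x′ ]))) ≡⟨ cong (λ l → length U + suc (length V + suc l)) (trans (length-++ T) (+-comm (length T) 1)) ⟩
    length U + suc (length V + suc (suc (length T)))    ≡⟨ shift (length U) (length V) (length T) ⟩
    suc (length U + suc (length V + suc (length T)))    ∎)
    where
    open ≡-Reasoning
    shift : ∀ u v t → u + suc (v + suc (suc t)) ≡ suc (u + suc (v + suc t))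
    shift = solve-∀

  occurrences : c ≢ y → c ≢ x′ → All (_≢ c) U → All (_≢ c) V → All (_≢ c) T →
                ∀ p → q < p → p ≤ b → word ! p ≡ c → p ≡ e ⊎ p ≡ f
  occurrences c≢y c≢x′ U≢c V≢c T≢c p q<p p≤b word!p≡c with m≤n⇒∃[o]m+o≡n q<p
  ... | j , refl with occurrence-split (y ∷ U) ((λ y≡c → c≢y (sym y≡c)) ∷ U≢c) j<window window!j≡c
    where
    j<window : j < length window
    j<window = subst (suc j ≤_) (sym length-window) (+-cancelˡ-≤ q (suc j) _ (subst (_≤ b) (sym (+-suc q j)) p≤b))
    window!j≡c : window ! j ≡ c
    window!j≡c = begin
      window ! j                            ≡⟨ sym (!-++ˡ window j<window) ⟩
      (window ++ y′ ∷ S) ! j                ≡⟨ sym (!-++ʳ L (suc j)) ⟩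
      (L ++ x ∷ window ++ y′ ∷ S) ! (q + suc j) ≡⟨ cong₂ _!_ (sym word≡) (+-suc q j) ⟩
      word ! suc (q + j)                    ≡⟨ word!p≡c ⟩
      c                                     ∎
      where open ≡-Reasoning
  ... | inj₁ j≡ = inj₁ (trans (cong (λ i → suc (q + i)) j≡) (sym (+-suc q _)))
  ... | inj₂ (j₂ , refl , j₂< , V!j₂≡c) with occurrence-split V V≢c j₂< V!j₂≡c
  ...   | inj₁ refl = inj₂ (shift q (length U) (length V))
    where
    shift : ∀ q u v → suc (q + suc (suc u + v)) ≡ q + suc (suc (u + suc v))
    shift = solve-∀
  ...   | inj₂ (j₃ , _ , j₃< , T!j₃≡c) = contradiction T!j₃≡c (!-All (T ++ [ x′ ]) (++⁺ T≢c ((λ x′≡c → c≢x′ (sym x′≡c)) ∷ [])) j₃<)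

  centre : ∀ {i d} → PalindromicAt word i d → c ≢ y → c ≢ x′ → All (_≢ c) U → All (_≢ c) V → All (_≢ c) T →
           (∀ r → word ! suc r ≡ x → word ! r ≢ y) → (∀ r → word ! suc r ≡ x′ → word ! r ≢ y′) →
           i ≤ e → e ≤ i + d → i + (i + d) ≡ e + e ⊎ i + (i + d) ≡ e + f
  centre pal c≢y c≢x′ U≢c V≢c T≢c no-yx no-y′x′ =
    palindromic-centre {q = q} {e} {f} {b} pal
      (λ r eq → subst (word ! r ≢_) (sym at-suc-q) (no-yx r (trans eq at-q)))
      (λ r eq → subst (word ! r ≢_) (sym at-suc-b) (no-y′x′ r (trans eq at-b)))
      (λ p q<p p≤b eq → occurrences c≢y c≢x′ U≢c V≢c T≢c p q<p p≤b (trans eq at-e))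
      (m<m+n q (s≤s z≤n)) (+-monoʳ-≤ q (s≤s (s≤s (m≤m+n (length U) _))))

module W₃ₖ₋₂ (m : ℕ) where

  open Morphism (suc m)

  -- This is 3k - 2, written so that W k n is visibly an image under φ_k.
  n : ℕ
  n = suc (m + 2 * k)

  k-1 top : ℕ
  k-1 = suc (suc m)
  top = k + k-1

  X : Word
  X = zimin (k-1)

  X₀ : Word
  X₀ = φ k (zimin (suc m))

  Y : Word
  Y = φ k (proj₁ (zimin-ends-with-0 m)) ++ [ 0 ]

  X≡X₀0 : X ≡ X₀ ++ [ 0 ]
  X≡X₀0 = sym (φ-zimin (suc m) (n≤1+n _))

  X₀≡Y1 : X₀ ≡ Y ++ [ 1 ]
  X₀≡Y1 = begin
    φ k (zimin (suc m))         ≡⟨ cong (φ k) (proj₂ (zimin-ends-with-0 m)) ⟩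
    φ k (Z ++ [ 0 ])            ≡⟨ φ-++ Z [ 0 ] ⟩
    φ k Z ++ φ-letter k 0 ++ [] ≡⟨ cong (λ z → φ k Z ++ z ++ []) (φ-letter-small 0 (s≤s (s≤s z≤n))) ⟩
    φ k Z ++ 0 ∷ 1 ∷ []         ≡⟨ sym (++-assoc (φ k Z) [ 0 ] [ 1 ]) ⟩
    Y ++ [ 1 ]                  ∎
    where
    open ≡-Reasoning
    Z : Word
    Z = proj₁ (zimin-ends-with-0 m)

  X≡0X₀ʳ : X ≡ 0 ∷ reverse X₀
  X≡0X₀ʳ = trans (sym (zimin-palindrome (k-1))) (trans (cong reverse X≡X₀0) (reverse-++ X₀ [ 0 ]))

  φX : φ k X ≡ X ++ k-1 ∷ X₀
  φX = ++-cancelʳ [ 0 ] (φ k X) (X ++ k-1 ∷ X₀) (begin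
    φ k X ++ [ 0 ]           ≡⟨ φ-zimin (k-1) ≤-refl ⟩
    X ++ k-1 ∷ X             ≡⟨ cong (λ z → X ++ k-1 ∷ z) X≡X₀0 ⟩
    X ++ k-1 ∷ X₀ ++ [ 0 ]   ≡⟨ sym (++-assoc X (k-1 ∷ X₀) [ 0 ]) ⟩
    (X ++ k-1 ∷ X₀) ++ [ 0 ] ∎)
    where open ≡-Reasoning

  W-k-1 : W k (k-1) ≡ X ++ [ k-1 ]
  W-k-1 = W-zimin (k-1) ≤-refl

  W-k : W k k ≡ X ++ k-1 ∷ Y ++ 1 ∷ k ∷ []
  W-k = begin
    φ k (W k (k-1))                  ≡⟨ cong (φ k) W-k-1 ⟩
    φ k (X ++ [ k-1 ])               ≡⟨ φ-++ X [ k-1 ] ⟩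
    φ k X ++ φ-letter k (k-1) ++ []  ≡⟨ cong₂ (λ u v → u ++ v ++ []) φX φ-letter-last ⟩
    (X ++ k-1 ∷ X₀) ++ [ k ]         ≡⟨ ++-assoc X (k-1 ∷ X₀) [ k ] ⟩
    X ++ k-1 ∷ X₀ ++ [ k ]           ≡⟨ cong (λ z → X ++ k-1 ∷ z ++ [ k ]) X₀≡Y1 ⟩
    X ++ k-1 ∷ (Y ++ [ 1 ]) ++ [ k ] ≡⟨ cong (λ z → X ++ k-1 ∷ z) (++-assoc Y [ 1 ] [ k ]) ⟩
    X ++ k-1 ∷ Y ++ 1 ∷ k ∷ []       ∎
    where open ≡-Reasoning

  kX kY : Word
  kX = k ⊕ X
  kY = k ⊕ Y

  i₀ : ℕ
  i₀ = k + suc m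

  v : Word
  v = proj₁ (W-prefix k (suc m))

  L : Word
  L = blocks k (suc (suc i₀)) (suc m) ++ blocks k (suc k) (suc m) ++ X ++ k-1 ∷ Y

  prefix-shape : blocks k (suc i₀) (k-1) ≡ L ++ 1 ∷ k ∷ kX ++ [ top ]
  prefix-shape = begin
    P₁ ++ W k (suc i₀)                                   ≡⟨ cong (λ j → P₁ ++ W k j) i₀+1≡ ⟩
    P₁ ++ W k (k-1 + k)                          ≡⟨ cong (P₁ ++_) (W-recurrence (k-1)) ⟩
    P₁ ++ (P₂ ++ W k k) ++ k ⊕ W k (k-1)         ≡⟨ cong₂ (λ u z → P₁ ++ (P₂ ++ u) ++ k ⊕ z) W-k W-k-1 ⟩
    P₁ ++ (P₂ ++ X ++ k-1 ∷ Y ++ 1 ∷ k ∷ []) ++ k ⊕ (X ++ [ k-1 ])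
      ≡⟨ cong (λ u → P₁ ++ (P₂ ++ u) ++ k ⊕ (X ++ [ k-1 ])) (sym (++-assoc X (k-1 ∷ Y) (1 ∷ k ∷ []))) ⟩
    P₁ ++ (P₂ ++ (X ++ k-1 ∷ Y) ++ 1 ∷ k ∷ []) ++ k ⊕ (X ++ [ k-1 ])
      ≡⟨ cong₂ (λ u z → P₁ ++ u ++ z) (sym (++-assoc P₂ (X ++ k-1 ∷ Y) (1 ∷ k ∷ []))) (map-++ (k +_) X [ k-1 ]) ⟩
    P₁ ++ ((P₂ ++ X ++ k-1 ∷ Y) ++ 1 ∷ k ∷ []) ++ kX ++ [ top ]
      ≡⟨ cong (P₁ ++_) (++-assoc (P₂ ++ X ++ k-1 ∷ Y) (1 ∷ k ∷ []) (kX ++ [ top ])) ⟩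
    P₁ ++ (P₂ ++ X ++ k-1 ∷ Y) ++ 1 ∷ k ∷ kX ++ [ top ]
      ≡⟨ sym (++-assoc P₁ (P₂ ++ X ++ k-1 ∷ Y) (1 ∷ k ∷ kX ++ [ top ])) ⟩
    L ++ 1 ∷ k ∷ kX ++ [ top ]                           ∎
    where
    open ≡-Reasoning
    P₁ P₂ : Word
    P₁ = blocks k (suc (suc i₀)) (suc m)
    P₂ = blocks k (suc k) (suc m)
    i₀+1≡ : suc i₀ ≡ k-1 + k
    i₀+1≡ = shift m
      where
      shift : ∀ m → suc (3 + m + suc m) ≡ suc (suc m) + (3 + m)
      shift = solve-∀

  suffix-shape : k ⊕ W k i₀ ≡ kX ++ top ∷ kY ++ (k + 1) ∷ (k + k) ∷ k ⊕ v
  suffix-shape = begin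
    k ⊕ W k i₀                                          ≡⟨ cong (k ⊕_) (proj₂ (W-prefix k (suc m))) ⟩
    k ⊕ (W k k ++ v)                                    ≡⟨ map-++ (k +_) (W k k) v ⟩
    k ⊕ W k k ++ k ⊕ v                                  ≡⟨ cong (λ z → k ⊕ z ++ k ⊕ v) W-k ⟩
    k ⊕ (X ++ k-1 ∷ Y ++ 1 ∷ k ∷ []) ++ k ⊕ v           ≡⟨ cong (_++ k ⊕ v) (map-++ (k +_) X (k-1 ∷ Y ++ 1 ∷ k ∷ [])) ⟩
    (kX ++ top ∷ k ⊕ (Y ++ 1 ∷ k ∷ [])) ++ k ⊕ v        ≡⟨ cong (λ z → (kX ++ top ∷ z) ++ k ⊕ v) (map-++ (k +_) Y (1 ∷ k ∷ [])) ⟩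
    (kX ++ top ∷ kY ++ (k + 1) ∷ (k + k) ∷ []) ++ k ⊕ v ≡⟨ ++-assoc kX (top ∷ kY ++ (k + 1) ∷ (k + k) ∷ []) (k ⊕ v) ⟩
    kX ++ top ∷ (kY ++ (k + 1) ∷ (k + k) ∷ []) ++ k ⊕ v ≡⟨ cong (λ z → kX ++ top ∷ z) (++-assoc kY ((k + 1) ∷ (k + k) ∷ []) (k ⊕ v)) ⟩
    kX ++ top ∷ kY ++ (k + 1) ∷ (k + k) ∷ k ⊕ v         ∎
    where open ≡-Reasoning

  open Window L kX kX kY (k ⊕ v) 1 k top (k + 1) (k + k)

  n≡i₀+k : n ≡ i₀ + k
  n≡i₀+k = reduce m
    where
    reduce : ∀ m → suc (m + 2 * (3 + m)) ≡ 3 + m + suc m + (3 + m)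
    reduce = solve-∀

  W-shape : W k n ≡ word
  W-shape = begin
    W k n                                         ≡⟨ cong (W k) n≡i₀+k ⟩
    W k (i₀ + k)                                  ≡⟨ W-recurrence i₀ ⟩
    blocks k (suc i₀) (k-1) ++ k ⊕ W k i₀         ≡⟨ cong₂ _++_ prefix-shape suffix-shape ⟩
    (L ++ 1 ∷ k ∷ kX ++ [ top ]) ++ kX ++ top ∷ R ≡⟨ ++-assoc L (1 ∷ k ∷ kX ++ [ top ]) (kX ++ top ∷ R) ⟩
    L ++ 1 ∷ k ∷ (kX ++ [ top ]) ++ kX ++ top ∷ R ≡⟨ cong (λ z → L ++ 1 ∷ k ∷ z) (++-assoc kX [ top ] (kX ++ top ∷ R)) ⟩
    word                                          ∎
    where
    open ≡-Reasoning
    R : Word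
    R = kY ++ (k + 1) ∷ (k + k) ∷ k ⊕ v

  eSplit≡ : eSplit k n ≡ suc e
  eSplit≡ = begin
    eSplit k n                             ≡⟨ eSplit-blocks k n ⟩
    length (blocks k (n ∸ k + 1) (k-1))    ≡⟨ cong (λ i → length (blocks k i (k-1))) start≡ ⟩
    length (blocks k (suc i₀) (k-1))       ≡⟨ cong length prefix-shape ⟩
    length (L ++ 1 ∷ k ∷ kX ++ [ top ])    ≡⟨ length-++ L ⟩
    q + suc (suc (length (kX ++ [ top ]))) ≡⟨ cong (λ l → q + suc (suc l)) (length-++ kX) ⟩
    q + suc (suc (length kX + 1))          ≡⟨ shift q (length kX) ⟩
    suc e                                  ∎
    where
    open ≡-Reasoning
    start≡ : n ∸ k + 1 ≡ suc i₀
    start≡ = trans (cong (λ j → j ∸ k + 1) n≡i₀+k) (trans (cong (_+ 1) (m+n∸n≡m i₀ k)) (+-comm i₀ 1))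
    shift : ∀ q x → q + suc (suc (x + 1)) ≡ suc (q + suc (suc x))
    shift = solve-∀

  A₁ B₁ A₂ B₂ : Word
  A₁ = k ⊕ W k (k ∸ 1)
  B₁ = k ⊕ (W k (k ∸ 1) · ((k ∸ 1) ∷ []) ⁻¹)
  A₂ = k ⊕ ((0 ∷ []) ⁻¹· W k (k ∸ 1))
  B₂ = k ⊕ ((W k (k ∸ 1) ++ W k (k ∸ 1)) · (0 ∷ (k ∸ 1) ∷ []) ⁻¹)

  kX₁ : Word
  kX₁ = k ⊕ reverse X₀

  kX≡ : kX ≡ (k + 0) ∷ kX₁
  kX≡ = cong (k ⊕_) X≡0X₀ʳ

  A₁≡ : A₁ ≡ kX ++ [ top ]
  A₁≡ = trans (cong (k ⊕_) W-k-1) (map-++ (k +_) X [ k-1 ])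

  B₁≡ : B₁ ≡ kX
  B₁≡ = trans (cong (λ z → k ⊕ (z · [ k-1 ] ⁻¹)) W-k-1) (cong (k ⊕_) (++-·⁻¹ X [ k-1 ]))

  palindrome₁ : Palindrome (A₁ ++ B₁)
  palindrome₁ = subst Palindrome (sym AB≡) (⊕-palindrome k (zimin-palindrome k))
    where
    AB≡ : A₁ ++ B₁ ≡ k ⊕ zimin k
    AB≡ = begin
      A₁ ++ B₁                  ≡⟨ cong (A₁ ++_) B₁≡ ⟩
      k ⊕ W k (k ∸ 1) ++ k ⊕ X  ≡⟨ sym (map-++ (k +_) (W k (k ∸ 1)) X) ⟩
      k ⊕ (W k (k ∸ 1) ++ X)    ≡⟨ cong (λ z → k ⊕ (z ++ X)) W-k-1 ⟩
      k ⊕ ((X ++ [ k-1 ]) ++ X) ≡⟨ cong (k ⊕_) (++-assoc X [ k-1 ] X) ⟩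
      k ⊕ zimin k               ∎
      where open ≡-Reasoning

  A₂≡′ : A₂ ≡ k ⊕ (reverse X₀ ++ [ k-1 ])
  A₂≡′ = cong (λ z → k ⊕ drop 1 z) (trans W-k-1 (cong (_++ [ k-1 ]) X≡0X₀ʳ))

  A₂≡ : A₂ ≡ kX₁ ++ [ top ]
  A₂≡ = trans A₂≡′ (map-++ (k +_) (reverse X₀) [ k-1 ])

  B₂≡′ : B₂ ≡ k ⊕ (X ++ k-1 ∷ X₀)
  B₂≡′ = trans (cong (λ z → k ⊕ (z · (0 ∷ k-1 ∷ []) ⁻¹)) WW≡) (cong (k ⊕_) (++-·⁻¹ (X ++ k-1 ∷ X₀) _))
    where
    WW≡ : W k (k ∸ 1) ++ W k (k ∸ 1) ≡ (X ++ k-1 ∷ X₀) ++ 0 ∷ k-1 ∷ []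
    WW≡ = begin
      W k (k ∸ 1) ++ W k (k ∸ 1)          ≡⟨ cong₂ _++_ W-k-1 W-k-1 ⟩
      (X ++ [ k-1 ]) ++ X ++ [ k-1 ]      ≡⟨ ++-assoc X [ k-1 ] (X ++ [ k-1 ]) ⟩
      X ++ k-1 ∷ X ++ [ k-1 ]             ≡⟨ cong (λ z → X ++ k-1 ∷ z ++ [ k-1 ]) X≡X₀0 ⟩
      X ++ k-1 ∷ (X₀ ++ [ 0 ]) ++ [ k-1 ] ≡⟨ cong (λ z → X ++ k-1 ∷ z) (++-assoc X₀ [ 0 ] [ k-1 ]) ⟩
      X ++ k-1 ∷ X₀ ++ 0 ∷ k-1 ∷ []       ≡⟨ sym (++-assoc X (k-1 ∷ X₀) (0 ∷ k-1 ∷ [])) ⟩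
      (X ++ k-1 ∷ X₀) ++ 0 ∷ k-1 ∷ []     ∎
      where open ≡-Reasoning

  B₂≡ : B₂ ≡ kX ++ top ∷ kY ++ [ k + 1 ]
  B₂≡ = begin
    B₂                           ≡⟨ B₂≡′ ⟩
    k ⊕ (X ++ k-1 ∷ X₀)          ≡⟨ map-++ (k +_) X (k-1 ∷ X₀) ⟩
    kX ++ top ∷ k ⊕ X₀           ≡⟨ cong (λ z → kX ++ top ∷ k ⊕ z) X₀≡Y1 ⟩
    kX ++ top ∷ k ⊕ (Y ++ [ 1 ]) ≡⟨ cong (λ z → kX ++ top ∷ z) (map-++ (k +_) Y [ 1 ]) ⟩
    kX ++ top ∷ kY ++ [ k + 1 ]  ∎
    where open ≡-Reasoning

  palindrome₂ : Palindrome (A₂ ++ B₂)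
  palindrome₂ = subst Palindrome (sym AB≡)
    (⊕-palindrome k (reverse-++-palindrome X₀ (reverse-++-palindrome [ k-1 ] (zimin-palindrome (k-1)))))
    where
    AB≡ : A₂ ++ B₂ ≡ k ⊕ (reverse X₀ ++ (k-1 ∷ X ++ [ k-1 ]) ++ X₀)
    AB≡ = begin
      A₂ ++ B₂                                           ≡⟨ cong₂ _++_ A₂≡′ B₂≡′ ⟩
      k ⊕ (reverse X₀ ++ [ k-1 ]) ++ k ⊕ (X ++ k-1 ∷ X₀) ≡⟨ sym (map-++ (k +_) (reverse X₀ ++ [ k-1 ]) _) ⟩
      k ⊕ ((reverse X₀ ++ [ k-1 ]) ++ X ++ k-1 ∷ X₀)     ≡⟨ cong (k ⊕_) (++-assoc (reverse X₀) [ k-1 ] _) ⟩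
      k ⊕ (reverse X₀ ++ k-1 ∷ X ++ k-1 ∷ X₀)            ≡⟨ cong (λ z → k ⊕ (reverse X₀ ++ k-1 ∷ z)) (sym (++-assoc X [ k-1 ] X₀)) ⟩
      k ⊕ (reverse X₀ ++ (k-1 ∷ X ++ [ k-1 ]) ++ X₀)     ∎
      where open ≡-Reasoning

  ℓ : ℕ
  ℓ = length Y

  length-kX : length kX ≡ suc (suc ℓ)
  length-kX = begin
    length kX                      ≡⟨ length-map (k +_) X ⟩
    length X                       ≡⟨ cong length (trans X≡X₀0 (cong (_++ [ 0 ]) X₀≡Y1)) ⟩
    length ((Y ++ [ 1 ]) ++ [ 0 ]) ≡⟨ length-++ (Y ++ [ 1 ]) ⟩
    length (Y ++ [ 1 ]) + 1        ≡⟨ cong (_+ 1) (length-++ Y) ⟩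
    ℓ + 1 + 1                      ≡⟨ shift ℓ ⟩
    suc (suc ℓ)                    ∎
    where
    open ≡-Reasoning
    shift : ∀ l → l + 1 + 1 ≡ suc (suc l)
    shift = solve-∀

  length-kX₁ : length kX₁ ≡ suc ℓ
  length-kX₁ = suc-injective (trans (cong length (sym kX≡)) length-kX)

  C₁ : Word
  C₁ = kY ++ (k + 1) ∷ (k + k) ∷ k ⊕ v

  a₁ a₂ : Word
  a₁ = L ++ [ 1 ]
  a₂ = L ++ 1 ∷ k ∷ []

  witness₁ : let s = suc (suc (length a₁)); t = suc (length a₁ + length A₁ + length B₁) in
             MaximalStraddling k n s t × ABStraddling k n A₁ B₁ s t
  witness₁ = maximal-witness {k} {n} a₁ k A₁ B₁ top C₁ W≡ (λ eq → m+1+n≢m k (sym eq)) e≡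
               (subst (λ z → 0 < length z) (sym A₁≡) (0<length-++-∷ kX))
               (subst (λ z → 0 < length z) (sym (trans B₁≡ kX≡)) (s≤s z≤n)) palindrome₁
    where
    open ≡-Reasoning
    W≡ : W k n ≡ a₁ ++ k ∷ A₁ ++ B₁ ++ top ∷ C₁
    W≡ = trans W-shape (sym (begin
      a₁ ++ k ∷ A₁ ++ B₁ ++ top ∷ C₁                        ≡⟨ cong₂ (λ x z → a₁ ++ k ∷ x ++ z ++ top ∷ C₁) A₁≡ B₁≡ ⟩
      (L ++ [ 1 ]) ++ k ∷ (kX ++ [ top ]) ++ kX ++ top ∷ C₁ ≡⟨ ++-assoc L [ 1 ] _ ⟩
      L ++ 1 ∷ k ∷ (kX ++ [ top ]) ++ kX ++ top ∷ C₁        ≡⟨ cong (λ z → L ++ 1 ∷ k ∷ z) (++-assoc kX [ top ] _) ⟩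
      word                                                  ∎))
    e≡ : eSplit k n ≡ suc (length a₁ + length A₁)
    e≡ = begin
      eSplit k n                      ≡⟨ eSplit≡ ⟩
      suc (q + suc (suc (length kX))) ≡⟨ shift q (length kX) ⟩
      suc (q + 1 + (length kX + 1))   ≡⟨ cong₂ (λ x y → suc (x + y)) (sym (length-++ L)) (sym (trans (cong length A₁≡) (length-++ kX))) ⟩
      suc (length a₁ + length A₁)     ∎
      where
      shift : ∀ q x → suc (q + suc (suc x)) ≡ suc (q + 1 + (x + 1))
      shift = solve-∀

  witness₂ : let s = suc (suc (length a₂)); t = suc (length a₂ + length A₂ + length B₂) in
             MaximalStraddling k n s t × ABStraddling k n A₂ B₂ s t
  witness₂ = maximal-witness {k} {n} a₂ (k + 0) A₂ B₂ (k + k) (k ⊕ v) W≡ k+0≢k+k e≡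
               (subst (λ z → 0 < length z) (sym A₂≡) (0<length-++-∷ kX₁))
               (subst (λ z → 0 < length z) (sym B₂≡) (0<length-++-∷ kX)) palindrome₂
    where
    open ≡-Reasoning
    k+0≢k+k : k + 0 ≢ k + k
    k+0≢k+k eq with +-cancelˡ-≡ k 0 k eq
    ... | ()
    W≡ : W k n ≡ a₂ ++ (k + 0) ∷ A₂ ++ B₂ ++ (k + k) ∷ k ⊕ v
    W≡ = trans W-shape (sym (begin
      a₂ ++ (k + 0) ∷ A₂ ++ B₂ ++ (k + k) ∷ k ⊕ v
        ≡⟨ cong₂ (λ x z → a₂ ++ (k + 0) ∷ x ++ z ++ (k + k) ∷ k ⊕ v) A₂≡ B₂≡ ⟩
      a₂ ++ (k + 0) ∷ (kX₁ ++ [ top ]) ++ (kX ++ top ∷ kY ++ [ k + 1 ]) ++ (k + k) ∷ k ⊕ v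
        ≡⟨ ++-assoc L (1 ∷ k ∷ []) _ ⟩
      L ++ 1 ∷ k ∷ (k + 0) ∷ (kX₁ ++ [ top ]) ++ (kX ++ top ∷ kY ++ [ k + 1 ]) ++ (k + k) ∷ k ⊕ v
        ≡⟨ cong (λ z → L ++ 1 ∷ k ∷ (k + 0) ∷ z) (++-assoc kX₁ [ top ] _) ⟩
      L ++ 1 ∷ k ∷ (k + 0) ∷ kX₁ ++ top ∷ (kX ++ top ∷ kY ++ [ k + 1 ]) ++ (k + k) ∷ k ⊕ v
        ≡⟨ cong (λ z → L ++ 1 ∷ k ∷ (k + 0) ∷ kX₁ ++ top ∷ z) (++-assoc kX (top ∷ kY ++ [ k + 1 ]) _) ⟩
      L ++ 1 ∷ k ∷ (k + 0) ∷ kX₁ ++ top ∷ kX ++ top ∷ (kY ++ [ k + 1 ]) ++ (k + k) ∷ k ⊕ v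
        ≡⟨ cong (λ z → L ++ 1 ∷ k ∷ (k + 0) ∷ kX₁ ++ top ∷ kX ++ top ∷ z) (++-assoc kY [ k + 1 ] _) ⟩
      L ++ 1 ∷ k ∷ (k + 0) ∷ kX₁ ++ top ∷ kX ++ top ∷ C₁
        ≡⟨ cong (λ z → L ++ 1 ∷ k ∷ z ++ top ∷ kX ++ top ∷ C₁) (sym kX≡) ⟩
      word                                              ∎))
    e≡ : eSplit k n ≡ suc (length a₂ + length A₂)
    e≡ = begin
      eSplit k n                             ≡⟨ eSplit≡ ⟩
      suc (q + suc (suc (length kX)))        ≡⟨ cong (λ x → suc (q + suc (suc x))) (trans length-kX (cong suc (sym length-kX₁))) ⟩
      suc (q + suc (suc (suc (length kX₁)))) ≡⟨ shift q (length kX₁) ⟩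
      suc (q + 2 + (length kX₁ + 1))         ≡⟨ cong₂ (λ x y → suc (x + y)) (sym (length-++ L)) (sym (trans (cong length A₂≡) (length-++ kX₁))) ⟩
      suc (length a₂ + length A₂)            ∎
      where
      shift : ∀ q x → suc (q + suc (suc (suc x))) ≡ suc (q + 2 + (x + 1))
      shift = solve-∀

  sum₁ : suc (suc (e + e)) ≡ suc (suc (length a₁)) + suc (length a₁ + length A₁ + length B₁)
  sum₁ rewrite length-++ L {[ 1 ]} | A₁≡ | B₁≡ | length-++ kX {[ top ]} | length-kX = identity q ℓ
    where
    identity : ∀ q l → suc (suc (q + suc (suc (suc (suc l))) + (q + suc (suc (suc (suc l))))))
                       ≡ suc (suc (q + 1)) + suc (q + 1 + (suc (suc l) + 1) + suc (suc l))
    identity = solve-∀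

  sum₂ : suc (suc (e + f)) ≡ suc (suc (length a₂)) + suc (length a₂ + length A₂ + length B₂)
  sum₂ rewrite length-++ L {1 ∷ k ∷ []} | A₂≡ | B₂≡ | length-++ kX₁ {[ top ]} | length-++ kX {top ∷ kY ++ [ k + 1 ]}
             | length-++ kY {[ k + 1 ]} | length-kX | length-kX₁ | length-map (k +_) Y = identity q ℓ
    where
    identity : ∀ q l → suc (suc (q + suc (suc (suc (suc l))) + (q + suc (suc (suc (suc l) + suc (suc (suc l)))))))
                       ≡ suc (suc (q + 2)) + suc (q + 2 + (suc l + 1) + (suc (suc l) + suc (l + 1)))
    identity = solve-∀

  word-preceded : ∀ {d} → d % k ≡ 0 → ∀ r → word ! suc r ≡ suc d → word ! r ≡ d
  word-preceded d%k≡0 r eq =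
    subst (λ w → w ! r ≡ _) W-shape (φ-preceded (W k (m + 2 * k)) d%k≡0 r (subst (λ w → w ! suc r ≡ _) (sym W-shape) eq))

  no-k1 : ∀ r → word ! suc r ≡ 1 → word ! r ≢ k
  no-k1 r eq eq′ with trans (sym eq′) (word-preceded refl r eq)
  ... | ()

  no-kk-k1 : ∀ r → word ! suc r ≡ k + 1 → word ! r ≢ k + k
  no-kk-k1 r eq eq′ = m+1+n≢m k (trans (sym eq′) (word-preceded (n%n≡0 k) r (trans eq (+-comm k 1))))

  top≢k+1 : top ≢ k + 1
  top≢k+1 eq with +-cancelˡ-≡ k (k-1) 1 eq
  ... | ()

  kX-avoids : All (_≢ top) kX
  kX-avoids = ⊕-avoids k X (zimin-< (k-1))

  kY-avoids : All (_≢ top) kY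
  kY-avoids = ⊕-avoids k Y (++⁻ˡ Y (++⁻ˡ (Y ++ [ 1 ]) (subst (All (_< k-1)) X≡Y10 (zimin-< (k-1)))))
    where
    X≡Y10 : X ≡ (Y ++ [ 1 ]) ++ [ 0 ]
    X≡Y10 = trans X≡X₀0 (cong (_++ [ 0 ]) X₀≡Y1)

  classify : (s t : ℕ) → MaximalStraddling k n s t → ABStraddling k n A₁ B₁ s t ⊎ ABStraddling k n A₂ B₂ s t
  classify s t mx@((_ , s≤e , e<t , _) , _) with straddling-shape {k} {n} (proj₁ mx)
  ... | i , d , refl , refl =
    Sum.map (agree witness₁ sum₁) (agree witness₂ sum₂)
            (centre palindromic (m+1+n≢m k) top≢k+1 kX-avoids kX-avoids kY-avoids no-k1 no-kk-k1 i≤e e≤i+d)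
    where
    agree : ∀ {A B s′ t′ c} → MaximalStraddling k n s′ t′ × ABStraddling k n A B s′ t′ → suc (suc c) ≡ s′ + t′ →
            i + (i + d) ≡ c → ABStraddling k n A B (suc i) (suc (i + d))
    agree witness sum refl = maximal-agrees {k} {n} mx witness (trans (endpoints-sum i d) sum)
    palindromic : PalindromicAt word i d
    palindromic = subst (λ w → PalindromicAt w i d) W-shape (straddling-palindromic {k} {n} (proj₁ mx))
    i≤e : i ≤ e
    i≤e = ≤-pred (subst (suc i ≤_) eSplit≡ s≤e)
    e≤i+d : e ≤ i + d
    e≤i+d = ≤-pred (≤-trans (n≤1+n _) (subst (_< suc (i + d)) eSplit≡ e<t))

lemma5p18 : (k : ℕ) → 3 ≤ k →
    let n = 3 * k ∸ 2
        A₁ = k ⊕ W k (k ∸ 1)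
        B₁ = k ⊕ (W k (k ∸ 1) · ((k ∸ 1) ∷ []) ⁻¹)
        A₂ = k ⊕ ((0 ∷ []) ⁻¹· W k (k ∸ 1))
        B₂ = k ⊕ ((W k (k ∸ 1) ++ W k (k ∸ 1)) · (0 ∷ (k ∸ 1) ∷ []) ⁻¹)
    in (Σ ℕ λ s → Σ ℕ λ t → MaximalStraddling k n s t × ABStraddling k n A₁ B₁ s t)
       × (Σ ℕ λ s → Σ ℕ λ t → MaximalStraddling k n s t × ABStraddling k n A₂ B₂ s t)
       × ((s t : ℕ) → MaximalStraddling k n s t →
            ABStraddling k n A₁ B₁ s t ⊎ ABStraddling k n A₂ B₂ s t)
lemma5p18 (suc (suc (suc m))) (s≤s (s≤s (s≤s _))) = (_ , _ , witness₁) , (_ , _ , witness₂) , classify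
  where open W₃ₖ₋₂ m
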